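{- Let $A\subseteq[N]$ have distinct subset products and be such that $\mathbf{V}_{\mathrm{large}}\times\mathbf{V}_{\mathrm{med}}$ is injective and nonzero on $A$. Let $\mathcal{P}_{\square}=\{p\in\mathcal{P}_{\mathrm{med}}:p^2\mid a\text{ for some }a\in A\}$ and $\mathcal{P}_{\not\square}=\mathcal{P}_{\mathrm{med}}\setminus\mathcal{P}_{\square}$. Let $G$, with edge set $E$, be a graph obtained from the prime factorization graph of $A$ by deleting some edges, such that $G$ contains no even circuits of length at most $2N^{1/12}$ and no odd cycles of length at most $N^{1/12}$ having a vertex in $\mathcal{P}_{\square}$. Then there is a set $E'\subseteq E$ with $|E'|\le\frac12(|\mathcal{P}_{\not\square}|+1)$ such that the graph with edge set $E\setminus E'$ contains no cycles of length at most $N^{1/12}$.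
   Context: A finite set $A\subset\mathbb{N}$ has distinct subset products if for any two distinct subsets $B,C\subseteq A$, $\prod_{b\in B}b\neq\prod_{c\in C}c$. Fix $N$; $\mathcal{P}_{\mathrm{med}}$ is the set of primes in $(N^{1/3},N^{1/2}]$, $\mathcal{P}_{\mathrm{large}}$ the set of primes in $(N^{1/2},N]$. $V_p(n)$ is the exponent of the prime $p$ in $n$, and $(\mathbf{V}_{\mathrm{large}}\times\mathbf{V}_{\mathrm{med}})(n)=(V_p(n))_{p\in\mathcal{P}_{\mathrm{large}}\cup\mathcal{P}_{\mathrm{med}}}$. The prime factorization graph $G(A)$ is the simple graph with vertex set $\mathcal{P}_{\mathrm{large}}\cup\mathcal{P}_{\mathrm{med}}\cup\{1\}$, in which $1$ is joined to $p\in\mathcal{P}_{\mathrm{large}}\cup\mathcal{P}_{\mathrm{med}}$ if some $a\in A$ has $V_p(a)=1$ and $V_q(a)=0$ for all other $q\in\mathcal{P}_{\mathrm{large}}\cup\mathcal{P}_{\mathrm{med}}$, and distinct $p,q\in\mathcal{P}_{\mathrm{large}}\cup\mathcal{P}_{\mathrm{med}}$ are joined if some element of $A$ is divisible by both $p$ and $q$. A cycle of length $k$ is a collection of edges $\{\{v_1,v_2\},\dots,\{v_{k-1},v_k\},\{v_k,v_1\}\}$ with $v_1,\dots,v_k$ distinct vertices; a circuit is the same with the $v_i$ not necessarily distinct; even/odd refers to the parity of $k$. -}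

module Defs where

open import Data.Nat using (ℕ; zero; suc; _+_; _*_; _^_; _≤_; _<_; _≤?_; _<?_)
open import Data.Nat.DivMod using (_/_)
open import Data.Nat.Divisibility using (_∣_; _∣?_)
open import Data.Nat.Primality using (Prime; prime?)
open import Data.List using (List; length; filter; upTo)
open import Data.Nat.ListAction using (product)
open import Data.List.Membership.Propositional using (_∈_)
open import Data.List.Relation.Unary.All using (All)
open import Data.List.Relation.Unary.Any using (Any; any?)
open import Data.List.Relation.Unary.Unique.Propositional using (Unique)
open import Data.List.Relation.Binary.Sublist.Propositional using (_⊆_)
open import Data.Product using (Σ; _×_; _,_; ∃)
open import Data.Sum using (_⊎_)
open import Relation.Nullary using (¬_; Dec; yes; no)
open import Relation.Nullary.Decidable using (_×-dec_; ¬?)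
open import Relation.Binary.PropositionalEquality using (_≡_; _≢_)

-- p-adic valuation V_p(n): exponent of p in n (with V_p(0) = 0, and
-- V_p(n) = 0 for p < 2; only used for primes p and n ≥ 1).
-- Fuel n suffices since each step divides by p ≥ 2.

valAux : ℕ → ℕ → ℕ → ℕ
valAux zero p m = 0
valAux (suc f) zero m = 0
valAux (suc f) (suc zero) m = 0
valAux (suc f) p@(suc (suc _)) zero = 0
valAux (suc f) p@(suc (suc _)) m@(suc _) with p ∣? m
... | yes _ = suc (valAux f p (m / p))
... | no _ = 0

V : ℕ → ℕ → ℕ
V p n = valAux n p n

-- Prime classes.  p ∈ (N^{1/3}, N^{1/2}]  ⇔  N < p^3 and p^2 ≤ N;
--                 p ∈ (N^{1/2}, N]        ⇔  N < p^2 and p ≤ N.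

Pmed : ℕ → ℕ → Set
Pmed N p = Prime p × (N < p ^ 3 × p ^ 2 ≤ N)

Plarge : ℕ → ℕ → Set
Plarge N p = Prime p × (N < p ^ 2 × p ≤ N)

Pbig : ℕ → ℕ → Set
Pbig N p = Plarge N p ⊎ Pmed N p

Vertex : ℕ → ℕ → Set
Vertex N v = v ≡ 1 ⊎ Pbig N v

-- Sets of naturals are represented by duplicate-free lists.

-- distinct subset products: sublists of a duplicate-free list are exactly
-- its subsets.
DistinctSubsetProducts : List ℕ → Set
DistinctSubsetProducts A =
  ∀ (B C : List ℕ) → B ⊆ A → C ⊆ A → product B ≡ product C → B ≡ C

InRange : ℕ → List ℕ → Set
InRange N A = All (λ a → 1 ≤ a × a ≤ N) A

VInjective : ℕ → List ℕ → Set
VInjective N A = ∀ a b → a ∈ A → b ∈ A →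
  (∀ p → Pbig N p → V p a ≡ V p b) → a ≡ b

VNonzero : ℕ → List ℕ → Set
VNonzero N A = ∀ a → a ∈ A → Σ ℕ λ p → Pbig N p × V p a ≢ 0

GA-Adj : ℕ → List ℕ → ℕ → ℕ → Set
GA-Adj N A u v =
    (u ≡ 1 × Pbig N v × Σ ℕ λ a → a ∈ A × V v a ≡ 1 ×
        (∀ q → Pbig N q → q ≢ v → V q a ≡ 0))
  ⊎ (v ≡ 1 × Pbig N u × Σ ℕ λ a → a ∈ A × V u a ≡ 1 ×
        (∀ q → Pbig N q → q ≢ u → V q a ≡ 0))
  ⊎ (Pbig N u × Pbig N v × u ≢ v × Σ ℕ λ a → a ∈ A × u ∣ a × v ∣ a)

-- Graphs given by an edge list (each edge an ordered pair, read unordered)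

Adj : List (ℕ × ℕ) → ℕ → ℕ → Set
Adj E u v = (u , v) ∈ E ⊎ (v , u) ∈ E

AdjMinus : List (ℕ × ℕ) → List (ℕ × ℕ) → ℕ → ℕ → Set
AdjMinus E E' u v = Adj E u v × ¬ Adj E' u v

SameEdge : ℕ → ℕ → ℕ → ℕ → Set
SameEdge a b c d = (a ≡ c × b ≡ d) ⊎ (a ≡ d × b ≡ c)

ClosedWalk : (ℕ → ℕ → Set) → ℕ → (ℕ → ℕ) → Set
ClosedWalk R k w = 3 ≤ k × w k ≡ w 0 × (∀ i → i < k → R (w i) (w (suc i)))

Cycle : (ℕ → ℕ → Set) → ℕ → (ℕ → ℕ) → Set
Cycle R k w = ClosedWalk R k w × (∀ i j → i < k → j < k → w i ≡ w j → i ≡ j)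

Circuit : (ℕ → ℕ → Set) → ℕ → (ℕ → ℕ) → Set
Circuit R k w = ClosedWalk R k w ×
  (∀ i j → i < j → j < k → ¬ SameEdge (w i) (w (suc i)) (w j) (w (suc j)))

Even Odd : ℕ → Set
Even k = Σ ℕ λ m → k ≡ 2 * m
Odd k = Σ ℕ λ m → k ≡ suc (2 * m)

Psq : ℕ → List ℕ → ℕ → Set
Psq N A p = Pmed N p × Any (λ a → (p ^ 2) ∣ a) A

pmed? : ∀ N p → Dec (Pmed N p)
pmed? N p = prime? p ×-dec ((N <? p ^ 3) ×-dec (p ^ 2 ≤? N))

pnsq? : ∀ N A p → Dec (Pmed N p × ¬ Any (λ a → (p ^ 2) ∣ a) A)
pnsq? N A p = pmed? N p ×-dec ¬? (any? (λ a → (p ^ 2) ∣? a) A)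

-- |P_{not □}|  (all such primes lie in [0, N])
countPnsq : ℕ → List ℕ → ℕ
countPnsq N A = length (filter (pnsq? N A) (upTo (suc N)))

-- While E ∖ E' has a cycle of length at most N^{1/12}, delete one of its edges. Such a cycle
-- is odd (an even cycle is an even circuit of length at most 2 N^{1/12}), hence avoids P_□. No element of [N]
-- is divisible by two large primes, so every edge not at 1 has a medium endpoint, and the cycle carries two
-- vertices of {1} ∪ P_{not □}; these are charged for the deleted edge. No vertex is charged twice: if a vertex
-- of the new odd cycle C also lies on an earlier cycle C' through a deleted edge (not an edge of C), follow C'
-- from C until it returns to C; together with one of the two arcs of C this closes an even circuit of length
-- at most |C| + |C'| ≤ 2 N^{1/12}. Hence 2 |E'| ≤ |P_{not □}| + 1.

module Submission where

open import Defs
open import Data.Empty using (⊥; ⊥-elim)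
open import Data.List using (List; []; _∷_; length; applyUpTo; map; _++_; filter; upTo)
open import Data.List.Properties using (length-applyUpTo; length-removeAt′)
open import Data.List.Membership.Propositional using (_∈_; _─_; find; lose)
open import Data.List.Membership.Propositional.Properties using (∈-map⁺; ∈-++⁺ˡ; ∈-++⁺ʳ; ∈-filter⁺; ∈-upTo⁺)
open import Data.List.Relation.Unary.All as All using (All; []; _∷_)
open import Data.List.Relation.Unary.All.Properties using (applyUpTo⁺₁)
open import Data.List.Relation.Unary.Any using (Any; any?; here; there; index)
open import Data.List.Relation.Unary.Unique.Propositional using (Unique; []; _∷_)
open import Data.Nat
open import Data.Nat.Divisibility using (_∣_; divides; ∣⇒≤)
open import Data.Nat.Primality using (Prime; prime⇒nonTrivial; prime⇒irreducible; euclidsLemma)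
open import Data.Nat.Properties
open import Algebra.Properties.CommutativeSemiring.Exp +-*-commutativeSemiring using (^-distrib-*)
open import Data.Nat.Tactic.RingSolver using (solve-∀)
open import Data.Product using (Σ; ∃-syntax; _×_; _,_; proj₁; proj₂)
open import Data.Product.Properties using (≡-dec)
open import Data.List.Membership.DecPropositional (≡-dec _≟_ _≟_) using (_∈?_)
open import Data.Sum using (_⊎_; inj₁; inj₂)
open import Function using (_∘_)
open import Relation.Binary.Definitions using (tri<; tri≈; tri>)
open import Relation.Binary.PropositionalEquality
open import Relation.Nullary using (¬_; Dec; yes; no)
open import Relation.Nullary.Decidable using (map′; _×-dec_; _⊎-dec_; _→-dec_; ¬?)
open import Relation.Unary using (Decidable)

module _ {P : ℕ → Set} (P? : Decidable P) where

  ∃<? : ∀ n → Dec (∃[ i ] i < n × P i)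
  ∃<? zero = no λ ()
  ∃<? (suc n) with P? n | ∃<? n
  ... | yes pn | _ = yes (n , ≤-refl , pn)
  ... | no _ | yes (i , i<n , pi) = yes (i , m<n⇒m<1+n i<n , pi)
  ... | no ¬pn | no ¬∃ = no none
    where
    none : ¬ (∃[ i ] i < suc n × P i)
    none (i , i<1+n , pi) with m≤n⇒m<n∨m≡n (s≤s⁻¹ i<1+n)
    ... | inj₁ i<n = ¬∃ (i , i<n , pi)
    ... | inj₂ refl = ¬pn pi

  ∀<? : ∀ n → Dec (∀ i → i < n → P i)
  ∀<? zero = yes λ _ ()
  ∀<? (suc n) with P? n | ∀<? n
  ... | no ¬pn | _ = no λ all → ¬pn (all n ≤-refl)
  ... | yes _ | no ¬all = no λ all → ¬all λ i i<n → all i (m<n⇒m<1+n i<n)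
  ... | yes pn | yes all = yes all′
    where
    all′ : ∀ i → i < suc n → P i
    all′ i i<1+n with m≤n⇒m<n∨m≡n (s≤s⁻¹ i<1+n)
    ... | inj₁ i<n = all i i<n
    ... | inj₂ refl = pn

  last≤ : P 0 → ∀ t → ∃[ i ] i ≤ t × P i × (∀ {j} → i < j → j ≤ t → ¬ P j)
  last≤ p0 zero = 0 , z≤n , p0 , λ i<j j≤0 → ⊥-elim (≤⇒≯ j≤0 i<j)
  last≤ p0 (suc t) with P? (suc t) | last≤ p0 t
  ... | yes pt | _ = suc t , ≤-refl , pt , λ i<j j≤t → ⊥-elim (≤⇒≯ j≤t i<j)
  ... | no ¬pt | i , i≤t , pi , none = i , m≤n⇒m≤1+n i≤t , pi , none′
    where
    none′ : ∀ {j} → i < j → j ≤ suc t → ¬ P j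
    none′ i<j j≤1+t with m≤n⇒m<n∨m≡n j≤1+t
    ... | inj₁ j<1+t = none i<j (s≤s⁻¹ j<1+t)
    ... | inj₂ refl = ¬pt

  first≥ : ∀ s d → P (s + d) → ∃[ j ] s ≤ j × j ≤ s + d × P j × (∀ {i} → s ≤ i → i < j → ¬ P i)
  first≥ s zero ps+0 = s , ≤-refl , ≤-reflexive (sym (+-identityʳ s)) , subst P (+-identityʳ s) ps+0 ,
    λ s≤i i<s → ⊥-elim (≤⇒≯ s≤i i<s)
  first≥ s (suc d) ps+1+d with P? s | first≥ (suc s) d (subst P (+-suc s d) ps+1+d)
  ... | yes ps | _ = s , ≤-refl , m≤m+n s (suc d) , ps , λ s≤i i<s → ⊥-elim (≤⇒≯ s≤i i<s)
  ... | no ¬ps | j , 1+s≤j , j≤ , pj , none = j , <⇒≤ 1+s≤j , subst (j ≤_) (sym (+-suc s d)) j≤ , pj , none′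
    where
    none′ : ∀ {i} → s ≤ i → i < j → ¬ P i
    none′ s≤i i<j with m≤n⇒m<n∨m≡n s≤i
    ... | inj₁ s<i = none s<i i<j
    ... | inj₂ refl = ¬ps

SameEdge-sym : ∀ {a b c d} → SameEdge a b c d → SameEdge c d a b
SameEdge-sym (inj₁ (refl , refl)) = inj₁ (refl , refl)
SameEdge-sym (inj₂ (refl , refl)) = inj₂ (refl , refl)

SameEdge-flipˡ : ∀ {a b c d} → SameEdge a b c d → SameEdge b a c d
SameEdge-flipˡ (inj₁ (refl , refl)) = inj₂ (refl , refl)
SameEdge-flipˡ (inj₂ (refl , refl)) = inj₁ (refl , refl)

SameEdge-flipʳ : ∀ {a b c d} → SameEdge a b c d → SameEdge a b d c
SameEdge-flipʳ (inj₁ (refl , refl)) = inj₂ (refl , refl)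
SameEdge-flipʳ (inj₂ (refl , refl)) = inj₁ (refl , refl)

SameEdge-resp : ∀ {a b c d a′ b′ c′ d′} → a ≡ a′ → b ≡ b′ → c ≡ c′ → d ≡ d′ →
  SameEdge a b c d → SameEdge a′ b′ c′ d′
SameEdge-resp refl refl refl refl s = s

Walk : (ℕ → ℕ → Set) → ℕ → (ℕ → ℕ) → Set
Walk R n p = ∀ i → i < n → R (p i) (p (suc i))

DistinctEdges : ℕ → (ℕ → ℕ) → Set
DistinctEdges n p = ∀ i j → i < j → j < n → ¬ SameEdge (p i) (p (suc i)) (p j) (p (suc j))

record Trail (R : ℕ → ℕ → Set) (n : ℕ) (p : ℕ → ℕ) : Set where
  constructor mkTrail
  field
    steps    : Walk R n p
    distinct : DistinctEdges n p

EdgeDisjoint : ℕ → (ℕ → ℕ) → ℕ → (ℕ → ℕ) → Set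
EdgeDisjoint n p m q = ∀ i j → i < n → j < m → ¬ SameEdge (p i) (p (suc i)) (q j) (q (suc j))

append : ℕ → (ℕ → ℕ) → (ℕ → ℕ) → ℕ → ℕ
append zero p q j = q j
append (suc L) p q zero = p zero
append (suc L) p q (suc j) = append L (p ∘ suc) q j

append-< : ∀ L p q {j} → j < L → append L p q j ≡ p j
append-< (suc L) p q {zero} _ = refl
append-< (suc L) p q {suc j} (s≤s j<L) = append-< L (p ∘ suc) q j<L

append-+ : ∀ L p q j → append L p q (L + j) ≡ q j
append-+ zero p q j = refl
append-+ (suc L) p q j = append-+ L (p ∘ suc) q j

append-≤ : ∀ L p q → p L ≡ q 0 → ∀ {j} → j ≤ L → append L p q j ≡ p j
append-≤ L p q pL≡q0 {j} j≤L with m≤n⇒m<n∨m≡n j≤L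
... | inj₁ j<L = append-< L p q j<L
... | inj₂ refl = begin
  append j p q j       ≡⟨ cong (append j p q) (+-identityʳ j) ⟨
  append j p q (j + 0) ≡⟨ append-+ j p q 0 ⟩
  q 0                  ≡⟨ pL≡q0 ⟨
  p j                  ∎
  where open ≡-Reasoning

AppendStep : ℕ → (ℕ → ℕ) → ℕ → (ℕ → ℕ) → ℕ → Set
AppendStep L p M q i =
    (i < L × append L p q i ≡ p i × append L p q (suc i) ≡ p (suc i))
  ⊎ (∃[ i′ ] i ≡ L + i′ × i′ < M × append L p q i ≡ q i′ × append L p q (suc i) ≡ q (suc i′))

appendStep : ∀ L p M q → p L ≡ q 0 → ∀ i → i < L + M → AppendStep L p M q i
appendStep L p M q pL≡q0 i i<L+M with i <? L
... | yes i<L = inj₁ (i<L , append-< L p q i<L , append-≤ L p q pL≡q0 i<L)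
... | no i≮L = inj₂ (i ∸ L , sym L+i′≡i , +-cancelˡ-< L _ _ (subst (_< L + M) (sym L+i′≡i) i<L+M) ,
                     trans (cong (append L p q) (sym L+i′≡i)) (append-+ L p q (i ∸ L)) ,
                     trans (cong (append L p q) L+1+i′≡1+i) (append-+ L p q (suc (i ∸ L))))
  where
  L+i′≡i : L + (i ∸ L) ≡ i
  L+i′≡i = m+[n∸m]≡n (≮⇒≥ i≮L)
  L+1+i′≡1+i : suc i ≡ L + suc (i ∸ L)
  L+1+i′≡1+i = sym (trans (+-suc L (i ∸ L)) (cong suc L+i′≡i))

Trail-append : ∀ {R} L p M q → Trail R L p → Trail R M q → p L ≡ q 0 → EdgeDisjoint L p M q →
  Trail R (L + M) (append L p q)
Trail-append {R} L p M q (mkTrail walk-p distinct-p) (mkTrail walk-q distinct-q) pL≡q0 disjoint =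
  mkTrail walk distinct
  where
  step = appendStep L p M q pL≡q0
  walk : Walk R (L + M) (append L p q)
  walk i i<n with step i i<n
  ... | inj₁ (i<L , e₁ , e₂) = subst₂ R (sym e₁) (sym e₂) (walk-p i i<L)
  ... | inj₂ (i′ , _ , i′<M , e₁ , e₂) = subst₂ R (sym e₁) (sym e₂) (walk-q i′ i′<M)
  distinct : DistinctEdges (L + M) (append L p q)
  distinct i j i<j j<n same with step i (<-trans i<j j<n) | step j j<n
  ... | inj₁ (i<L , a₁ , a₂) | inj₁ (j<L , b₁ , b₂) =
    distinct-p i j i<j j<L (SameEdge-resp a₁ a₂ b₁ b₂ same)
  ... | inj₁ (i<L , a₁ , a₂) | inj₂ (j′ , _ , j′<M , b₁ , b₂) =
    disjoint i j′ i<L j′<M (SameEdge-resp a₁ a₂ b₁ b₂ same)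
  ... | inj₂ (i′ , refl , _) | inj₁ (j<L , _) = <-asym (≤-trans (s≤s (m≤m+n L i′)) i<j) j<L
  ... | inj₂ (i′ , refl , _ , a₁ , a₂) | inj₂ (j′ , refl , j′<M , b₁ , b₂) =
    distinct-q i′ j′ (+-cancelˡ-< L _ _ i<j) j′<M (SameEdge-resp a₁ a₂ b₁ b₂ same)

shift : ℕ → (ℕ → ℕ) → ℕ → ℕ
shift s p j = p (s + j)

shift-suc : ∀ s p j → shift s p (suc j) ≡ p (suc (s + j))
shift-suc s p j = cong p (+-suc s j)

+-<-≤-trans : ∀ s {i L n} → i < L → s + L ≤ n → s + i < n
+-<-≤-trans s i<L s+L≤n = <-≤-trans (+-monoʳ-< s i<L) s+L≤n

Trail-shift : ∀ {R} n p s L → Trail R n p → s + L ≤ n → Trail R L (shift s p)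
Trail-shift {R} n p s L (mkTrail walk-p distinct-p) s+L≤n = mkTrail walk distinct
  where
  walk : Walk R L (shift s p)
  walk i i<L = subst (R (p (s + i))) (sym (shift-suc s p i)) (walk-p (s + i) (+-<-≤-trans s i<L s+L≤n))
  distinct : DistinctEdges L (shift s p)
  distinct i j i<j j<L same = distinct-p (s + i) (s + j) (+-monoʳ-< s i<j) (+-<-≤-trans s j<L s+L≤n)
    (SameEdge-resp refl (shift-suc s p i) refl (shift-suc s p j) same)

reverse : ℕ → (ℕ → ℕ) → ℕ → ℕ
reverse n p j = p (n ∸ j)

reverse-step : ∀ n p {j} → j < n → reverse n p j ≡ p (suc (n ∸ suc j))
reverse-step (suc n) p {zero} _ = refl
reverse-step (suc n) p {suc j} (s≤s j<n) = reverse-step n p j<n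

∸-suc-< : ∀ n {j} → j < n → n ∸ suc j < n
∸-suc-< (suc n) {j} _ = s≤s (m∸n≤m n j)

Trail-reverse : ∀ {R} → (∀ {u v} → R u v → R v u) → ∀ n p → Trail R n p → Trail R n (reverse n p)
Trail-reverse {R} R-sym n p (mkTrail walk-p distinct-p) = mkTrail walk distinct
  where
  walk : Walk R n (reverse n p)
  walk i i<n = subst (λ x → R x (p (n ∸ suc i))) (sym (reverse-step n p i<n))
    (R-sym (walk-p (n ∸ suc i) (∸-suc-< n i<n)))
  distinct : DistinctEdges n (reverse n p)
  distinct i j i<j j<n same = distinct-p (n ∸ suc j) (n ∸ suc i) (∸-monoʳ-< (s≤s i<j) j<n)
    (∸-suc-< n (<-trans i<j j<n))
    (SameEdge-sym (SameEdge-flipˡ (SameEdge-flipʳ (SameEdge-resp (reverse-step n p (<-trans i<j j<n)) refl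
                                                  (reverse-step n p j<n) refl same))))

-- Two reversed equal edges w i w (i+1) and w j w (j+1) force j ≡ i + 1 and w i ≡ w (i + 2), which injectivity
-- rules out unless i + 2 ≡ k, i.e. i ≡ 0 and k ≡ 2.
cycle⇒distinctEdges : ∀ {R k w} → Cycle R k w → DistinctEdges k w
cycle⇒distinctEdges ((_ , _ , _) , injective) i j i<j j<k (inj₁ (wi≡wj , _)) =
  <-irrefl (injective i j (<-trans i<j j<k) j<k wi≡wj) i<j
cycle⇒distinctEdges {k = k} {w} ((3≤k , wk≡w0 , _) , injective) i j i<j j<k (inj₂ (wi≡wj+1 , wi+1≡wj))
  with injective (suc i) j (≤-trans (s≤s i<j) j<k) j<k wi+1≡wj
... | refl with suc (suc i) <? k
...   | yes i+2<k = <-irrefl (injective i (suc (suc i)) (<-trans (n<1+n i) (<-trans (n<1+n _) i+2<k)) i+2<k wi≡wj+1)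
                              (<-trans (n<1+n i) (n<1+n (suc i)))
...   | no i+2≮k with ≤-antisym (≮⇒≥ i+2≮k) j<k
...     | refl with injective i 0 (<-trans (n<1+n i) (n<1+n (suc i))) (<-≤-trans z<s 3≤k) (trans wi≡wj+1 wk≡w0)
...       | refl = <-irrefl refl (<-≤-trans (s≤s (s≤s (s≤s z≤n))) 3≤k)

cycle⇒trail : ∀ {R k w} → Cycle R k w → Trail R k w
cycle⇒trail {R} c@((_ , _ , steps) , _) = mkTrail steps (cycle⇒distinctEdges {R} c)

module Rotation {R : ℕ → ℕ → Set} (k : ℕ) (w : ℕ → ℕ) (trail : Trail R k w) (closed : w k ≡ w 0)
                (s : ℕ) (s≤k : s ≤ k) where

  rotation : ℕ → ℕ
  rotation = append (k ∸ s) (shift s w) w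

  private
    junction : shift s w (k ∸ s) ≡ w 0
    junction = trans (cong w (m+[n∸m]≡n s≤k)) closed

    length≡ : k ∸ s + s ≡ k
    length≡ = m∸n+n≡m s≤k

    s+[k∸s]≡k : s + (k ∸ s) ≡ k
    s+[k∸s]≡k = m+[n∸m]≡n s≤k

    shift-< : ∀ {i} → i < k ∸ s → suc (s + i) ≤ k
    shift-< {i} i<k∸s = subst (_≤ k) (+-suc s i) (≤-trans (+-monoʳ-≤ s i<k∸s) (≤-reflexive s+[k∸s]≡k))

  rotation-trail : Trail R k rotation
  rotation-trail = subst (λ n → Trail R n rotation) length≡
    (Trail-append (k ∸ s) (shift s w) s w (Trail-shift k w s (k ∸ s) trail (≤-reflexive s+[k∸s]≡k))
                  (Trail-shift k w 0 s trail s≤k) junction disjoint)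
    where
    disjoint : EdgeDisjoint (k ∸ s) (shift s w) s w
    disjoint i j i<k∸s j<s same = Trail.distinct trail j (s + i) (≤-trans j<s (m≤m+n s i)) (shift-< i<k∸s)
      (SameEdge-sym (SameEdge-resp refl (shift-suc s w i) refl refl same))

  rotation-start : rotation 0 ≡ w s
  rotation-start = trans (append-≤ (k ∸ s) (shift s w) w junction z≤n) (cong w (+-identityʳ s))

  rotation-closed : rotation k ≡ rotation 0
  rotation-closed = begin
    rotation k           ≡⟨ cong rotation length≡ ⟨
    rotation (k ∸ s + s) ≡⟨ append-+ (k ∸ s) (shift s w) w s ⟩
    w s                  ≡⟨ rotation-start ⟨
    rotation 0           ∎
    where open ≡-Reasoning

  rotatedStep⇒step : ∀ {t′} → t′ < k →
    ∃[ t ] t < k × rotation t′ ≡ w t × rotation (suc t′) ≡ w (suc t)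
  rotatedStep⇒step {t′} t′<k
    with appendStep (k ∸ s) (shift s w) s w junction t′ (subst (t′ <_) (sym length≡) t′<k)
  ... | inj₁ (t′<k∸s , e₁ , e₂) = s + t′ , shift-< t′<k∸s , e₁ , trans e₂ (shift-suc s w t′)
  ... | inj₂ (t , _ , t<s , e₁ , e₂) = t , <-≤-trans t<s s≤k , e₁ , e₂

  step⇒rotatedStep : ∀ {t} → t < k →
    ∃[ t′ ] t′ < k × rotation t′ ≡ w t × rotation (suc t′) ≡ w (suc t)
  step⇒rotatedStep {t} t<k with t <? s
  ... | yes t<s = k ∸ s + t , subst (k ∸ s + t <_) length≡ (+-monoʳ-< (k ∸ s) t<s) ,
        append-+ (k ∸ s) (shift s w) w t ,
        trans (cong rotation (sym (+-suc (k ∸ s) t))) (append-+ (k ∸ s) (shift s w) w (suc t))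
  ... | no t≮s = t ∸ s , ≤-trans (s≤s (m∸n≤m t s)) t<k ,
        trans (append-< (k ∸ s) (shift s w) w t∸s<k∸s) (cong w s+[t∸s]≡t) ,
        trans (append-≤ (k ∸ s) (shift s w) w junction t∸s<k∸s)
              (trans (shift-suc s w (t ∸ s)) (cong (w ∘ suc) s+[t∸s]≡t))
    where
    s+[t∸s]≡t : s + (t ∸ s) ≡ t
    s+[t∸s]≡t = m+[n∸m]≡n (≮⇒≥ t≮s)
    t∸s<k∸s : t ∸ s < k ∸ s
    t∸s<k∸s = ∸-monoˡ-< t<k (≮⇒≥ t≮s)

cycle⇒circuit : ∀ {R k w} → Cycle R k w → Circuit R k w
cycle⇒circuit {R} c = proj₁ c , cycle⇒distinctEdges {R} c

Cycle-mono : ∀ {R S : ℕ → ℕ → Set} → (∀ {u v} → R u v → S u v) → ∀ {k w} → Cycle R k w → Cycle S k w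
Cycle-mono R⊆S ((3≤k , closed , steps) , injective) = (3≤k , closed , λ i i<k → R⊆S (steps i i<k)) , injective

OnWalk : ℕ → (ℕ → ℕ) → ℕ → Set
OnWalk k Z v = ∃[ a ] a < k × Z a ≡ v

EdgeOf : ℕ → (ℕ → ℕ) → ℕ → ℕ → Set
EdgeOf k Z u v = ∃[ s ] s < k × SameEdge u v (Z s) (Z (suc s))

onWalk? : ∀ k Z → Decidable (OnWalk k Z)
onWalk? k Z v = ∃<? (λ a → Z a ≟ v) k

module _ {k : ℕ} {Z : ℕ → ℕ} (closed-Z : Z k ≡ Z 0) (0<k : 0 < k) where

  OnWalk-suc : ∀ {s} → s < k → OnWalk k Z (Z (suc s))
  OnWalk-suc {s} s<k with m≤n⇒m<n∨m≡n s<k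
  ... | inj₁ 1+s<k = suc s , 1+s<k , refl
  ... | inj₂ refl = 0 , 0<k , sym closed-Z

  ¬OnWalkˡ⇒¬EdgeOf : ∀ {u v} → ¬ OnWalk k Z u → ¬ EdgeOf k Z u v
  ¬OnWalkˡ⇒¬EdgeOf u∉Z (s , s<k , inj₁ (u≡Zs , _)) = u∉Z (s , s<k , sym u≡Zs)
  ¬OnWalkˡ⇒¬EdgeOf u∉Z (s , s<k , inj₂ (u≡Zs+1 , _)) = u∉Z (subst (OnWalk k Z) (sym u≡Zs+1) (OnWalk-suc s<k))

  ¬OnWalkʳ⇒¬EdgeOf : ∀ {u v} → ¬ OnWalk k Z v → ¬ EdgeOf k Z u v
  ¬OnWalkʳ⇒¬EdgeOf v∉Z (s , s<k , same) = ¬OnWalkˡ⇒¬EdgeOf v∉Z (s , s<k , SameEdge-flipˡ same)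

module _ {R : ℕ → ℕ → Set} {k : ℕ} {w : ℕ → ℕ} (cycle : Cycle R k w) where

  private
    3≤k = proj₁ (proj₁ cycle)
    closed = proj₁ (proj₂ (proj₁ cycle))
    injective = proj₂ cycle
    0<k = <-≤-trans z<s 3≤k
    1<k = <-≤-trans (s≤s z<s) 3≤k

  cycle-edgeAvoidingPosition : ∀ {r} → r < k → ∃[ i ] i < k × w i ≢ w r × w (suc i) ≢ w r
  cycle-edgeAvoidingPosition {zero} r<k =
    1 , 1<k , (λ w1≡w0 → 1+n≢0 (injective 1 0 1<k r<k w1≡w0)) , (λ w2≡w0 → 1+n≢0 (injective 2 0 3≤k r<k w2≡w0))
  cycle-edgeAvoidingPosition {suc zero} r<k = 2 , 3≤k , (λ w2≡w1 → 1+n≢n (injective 2 1 3≤k r<k w2≡w1)) , w3≢w1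
    where
    w3≢w1 : w 3 ≢ w 1
    w3≢w1 w3≡w1 with 3 <? k
    ... | yes 3<k with () ← injective 3 1 3<k r<k w3≡w1
    ... | no 3≮k with refl ← ≤-antisym (≮⇒≥ 3≮k) 3≤k
                 with () ← injective 0 1 0<k r<k (trans (sym closed) w3≡w1)
  cycle-edgeAvoidingPosition {suc (suc r)} r<k =
    0 , 0<k , (λ w0≡wr → 0≢1+n (injective 0 _ 0<k r<k w0≡wr)) , (λ w1≡wr → m≢1+m+n 1 (injective 1 _ 1<k r<k w1≡wr))

  cycle-edgeAvoiding : ∀ v → ∃[ i ] i < k × w i ≢ v × w (suc i) ≢ v
  cycle-edgeAvoiding v with onWalk? k w v
  ... | yes (r , r<k , refl) = cycle-edgeAvoidingPosition r<k
  ... | no v∉w = 0 , 0<k , (λ w0≡v → v∉w (0 , 0<k , w0≡v)) , (λ w1≡v → v∉w (1 , 1<k , w1≡v))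

-- Even circuits from an odd closed trail and a closed trail

EvenCircuitOfLength≤ : (ℕ → ℕ → Set) → ℕ → Set
EvenCircuitOfLength≤ R m = ∃[ n ] ∃[ W ] Circuit R n W × Even n × n ≤ m

closedTrail⇒circuit : ∀ {R} n W → Trail R n W → W n ≡ W 0 → 1 ≤ n → Even n → Circuit R n W
closedTrail⇒circuit n W _ _ 1≤n (zero , refl) with () ← 1≤n
closedTrail⇒circuit n W (mkTrail _ distinct) closed _ (suc zero , refl) =
  ⊥-elim (distinct 0 1 z<s (s≤s z<s) (inj₂ (sym closed , refl)))
closedTrail⇒circuit n W (mkTrail walk distinct) closed _ (suc (suc m) , refl) =
  (s≤s (s≤s (≤-trans z<s (m≤n+m _ m))) , closed , walk) , distinct

Even⊎Odd : ∀ n → Even n ⊎ Odd n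
Even⊎Odd zero = inj₁ (0 , refl)
Even⊎Odd (suc n) with Even⊎Odd n
... | inj₁ (m , refl) = inj₂ (m , refl)
... | inj₂ (m , refl) = inj₁ (suc m , cong suc (sym (+-suc m (m + 0))))

Odd⇒Odd[2*L+k] : ∀ L {k} → Odd k → Odd (2 * L + k)
Odd⇒Odd[2*L+k] L (m , refl) = L + m , regroup L m
  where
  regroup : ∀ L m → 2 * L + suc (2 * m) ≡ suc (2 * (L + m))
  regroup = solve-∀

Odd-+-cancelʳ : ∀ x {y} → Odd (x + y) → Odd y → Even x
Odd-+-cancelʳ x {y} (n , x+y≡1+2n) (m , refl) = n ∸ m , x≡2[n∸m]
  where
  open ≡-Reasoning
  x≡2[n∸m] : x ≡ 2 * (n ∸ m)
  x≡2[n∸m] = begin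
    x                 ≡⟨ m+n∸n≡m x (2 * m) ⟨
    x + 2 * m ∸ 2 * m ≡⟨ cong (_∸ 2 * m) (suc-injective (trans (sym (+-suc x (2 * m))) x+y≡1+2n)) ⟩
    2 * n ∸ 2 * m     ≡⟨ *-distribˡ-∸ 2 n m ⟨
    2 * (n ∸ m)       ∎

module _ {R : ℕ → ℕ → Set} (R-sym : ∀ {u v} → R u v → R v u) where

  -- The path p joins Z 0 to Z c; one of the two closed trails formed by p and an arc of Z has
  -- even length, since their lengths L + c and L + (k ∸ c) add up to the odd number 2 L + k.
  oddClosedTrail+ear⇒evenCircuit :
    ∀ k Z → Trail R k Z → Z k ≡ Z 0 → Odd k →
    ∀ L p → Trail R L p → 1 ≤ L → EdgeDisjoint L p k Z →
    ∀ c → c < k → p 0 ≡ Z 0 → p L ≡ Z c →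
    EvenCircuitOfLength≤ R (L + k)
  oddClosedTrail+ear⇒evenCircuit k Z trail-Z closed-Z odd-k L p trail-p 1≤L disjoint c c<k p0≡Z0 pL≡Zc
    with Even⊎Odd (L + c)
  ... | inj₁ even = L + c , viaBackwardArc ,
          closedTrail⇒circuit (L + c) viaBackwardArc backward-trail backward-closed (≤-trans 1≤L (m≤m+n L c)) even ,
          even , +-monoʳ-≤ L (<⇒≤ c<k)
    where
    viaBackwardArc = append L p (reverse c Z)
    backward-trail : Trail R (L + c) viaBackwardArc
    backward-trail = Trail-append L p c (reverse c Z) trail-p
      (Trail-reverse R-sym c Z (Trail-shift k Z 0 c trail-Z (<⇒≤ c<k))) pL≡Zc
      λ i j i<L j<c same → disjoint i (c ∸ suc j) i<L (≤-trans (∸-suc-< c j<c) (<⇒≤ c<k))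
        (SameEdge-flipʳ (SameEdge-resp refl refl (reverse-step c Z j<c) refl same))
    backward-closed : viaBackwardArc (L + c) ≡ viaBackwardArc 0
    backward-closed = begin
      viaBackwardArc (L + c) ≡⟨ append-+ L p (reverse c Z) c ⟩
      Z (c ∸ c)              ≡⟨ cong Z (n∸n≡0 c) ⟩
      Z 0                    ≡⟨ p0≡Z0 ⟨
      p 0                    ≡⟨ append-≤ L p (reverse c Z) pL≡Zc z≤n ⟨
      viaBackwardArc 0       ∎
      where open ≡-Reasoning
  ... | inj₂ odd = L + (k ∸ c) , viaForwardArc ,
          closedTrail⇒circuit (L + (k ∸ c)) viaForwardArc forward-trail forward-closed (≤-trans 1≤L (m≤m+n L _)) even ,
          even , +-monoʳ-≤ L (m∸n≤m k c)
    where
    c+[k∸c]≡k : c + (k ∸ c) ≡ k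
    c+[k∸c]≡k = m+[n∸m]≡n (<⇒≤ c<k)
    viaForwardArc = append L p (shift c Z)
    pL≡Zc+0 : p L ≡ shift c Z 0
    pL≡Zc+0 = trans pL≡Zc (cong Z (sym (+-identityʳ c)))
    forward-trail : Trail R (L + (k ∸ c)) viaForwardArc
    forward-trail = Trail-append L p (k ∸ c) (shift c Z) trail-p
      (Trail-shift k Z c (k ∸ c) trail-Z (≤-reflexive c+[k∸c]≡k)) pL≡Zc+0
      λ i j i<L j<k∸c same → disjoint i (c + j) i<L (+-<-≤-trans c j<k∸c (≤-reflexive c+[k∸c]≡k))
        (SameEdge-resp refl refl refl (shift-suc c Z j) same)
    forward-closed : viaForwardArc (L + (k ∸ c)) ≡ viaForwardArc 0
    forward-closed = begin
      viaForwardArc (L + (k ∸ c)) ≡⟨ append-+ L p (shift c Z) (k ∸ c) ⟩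
      Z (c + (k ∸ c))             ≡⟨ cong Z c+[k∸c]≡k ⟩
      Z k                         ≡⟨ trans closed-Z (sym p0≡Z0) ⟩
      p 0                         ≡⟨ append-≤ L p (shift c Z) pL≡Zc+0 z≤n ⟨
      viaForwardArc 0             ∎
      where open ≡-Reasoning
    sum≡ : (L + (k ∸ c)) + (L + c) ≡ 2 * L + k
    sum≡ = trans (regroup L (k ∸ c) c) (cong (2 * L +_) (m∸n+n≡m (<⇒≤ c<k)))
      where
      regroup : ∀ L d c → (L + d) + (L + c) ≡ 2 * L + (d + c)
      regroup = solve-∀
    even : Even (L + (k ∸ c))
    even = Odd-+-cancelʳ (L + (k ∸ c)) (subst Odd (sym sum≡) (Odd⇒Odd[2*L+k] L odd-k)) odd

Ear : ℕ → (ℕ → ℕ) → ℕ → (ℕ → ℕ) → Set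
Ear k Z m Y = ∃[ i ] ∃[ L ] 1 ≤ L × i + L ≤ m × OnWalk k Z (Y i) × OnWalk k Z (Y (i + L)) ×
  EdgeDisjoint L (shift i Y) k Z

module _ {k : ℕ} {Z : ℕ → ℕ} (closed-Z : Z k ≡ Z 0) (0<k : 0 < k) where

  -- Around an edge of Y off Z, take the maximal stretch of Y whose inner vertices avoid Z.
  ear : ∀ m Y → Y m ≡ Y 0 → OnWalk k Z (Y 0) → ∀ {t} → t < m → ¬ EdgeOf k Z (Y t) (Y (suc t)) → Ear k Z m Y
  ear m Y closed-Y Y0∈Z {t} t<m t∉Z
    with last≤ (onWalk? k Z ∘ Y) Y0∈Z t
       | first≥ (onWalk? k Z ∘ Y) (suc t) (m ∸ suc t) (subst (OnWalk k Z ∘ Y) (sym (m+[n∸m]≡n t<m)) Ym∈Z)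
    where
    Ym∈Z : OnWalk k Z (Y m)
    Ym∈Z = subst (OnWalk k Z) (sym closed-Y) Y0∈Z
  ... | i , i≤t , Yi∈Z , offZ-before | j , t<j , j≤m , Yj∈Z , offZ-after =
    i , j ∸ i , m<n⇒0<n∸m i<j , subst (_≤ m) (sym i+L≡j) (subst (j ≤_) (m+[n∸m]≡n t<m) j≤m) ,
    Yi∈Z , subst (OnWalk k Z ∘ Y) (sym i+L≡j) Yj∈Z , disjoint
    where
    i<j = <-≤-trans (s≤s i≤t) t<j
    i+L≡j = m+[n∸m]≡n (<⇒≤ i<j)
    disjoint : EdgeDisjoint (j ∸ i) (shift i Y) k Z
    disjoint e s e<L s<k same with <-cmp (i + e) t | SameEdge-resp refl (shift-suc i Y e) refl refl same
    ... | tri< i+e<t _ _ | same′ =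
      ¬OnWalkʳ⇒¬EdgeOf closed-Z 0<k (offZ-before (s≤s (m≤m+n i e)) i+e<t) (s , s<k , same′)
    ... | tri≈ _ i+e≡t _ | same′ =
      t∉Z (s , s<k , subst (λ x → SameEdge (Y x) (Y (suc x)) (Z s) (Z (suc s))) i+e≡t same′)
    ... | tri> _ _ t<i+e | same′ =
      ¬OnWalkˡ⇒¬EdgeOf closed-Z 0<k (offZ-after t<i+e (subst (i + e <_) i+L≡j (+-monoʳ-< i e<L))) (s , s<k , same′)

module _ {R : ℕ → ℕ → Set} (R-sym : ∀ {u v} → R u v → R v u) where

  -- Rotate Y to start on Z, cut out an ear of Y attached to Z, and rotate Z to start at the ear.
  oddClosedTrail∪closedTrail⇒evenCircuit :
    ∀ k Z → Trail R k Z → Z k ≡ Z 0 → Odd k →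
    ∀ m Y → Trail R m Y → Y m ≡ Y 0 →
    ∀ {a b} → a < k → b < m → Z a ≡ Y b →
    ∀ {t} → t < m → ¬ EdgeOf k Z (Y t) (Y (suc t)) →
    EvenCircuitOfLength≤ R (m + k)
  oddClosedTrail∪closedTrail⇒evenCircuit
    k Z trail-Z closed-Z odd-k m Y trail-Y closed-Y {a} {b} a<k b<m Za≡Yb {t} t<m t∉Z =
    viaRotatedY (RY.step⇒rotatedStep t<m)
    where
    module RY = Rotation m Y trail-Y closed-Y b (<⇒≤ b<m)
    Y′ = RY.rotation

    viaEar : Ear k Z m Y′ → EvenCircuitOfLength≤ R (m + k)
    viaEar (i , L , 1≤L , i+L≤m , (α , α<k , Zα≡Y′i) , (β , β<k , Zβ≡Y′i+L) , disjoint) =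
      let c , c<k , Z′c≡Zβ , _ = RZ.step⇒rotatedStep β<k
          n , W , circuit , even , n≤L+k = oddClosedTrail+ear⇒evenCircuit R-sym k Z′ RZ.rotation-trail
            RZ.rotation-closed odd-k L (shift i Y′) (Trail-shift m Y′ i L RY.rotation-trail i+L≤m)
            1≤L disjoint′ c c<k (trans (cong Y′ (+-identityʳ i)) (trans (sym Zα≡Y′i) (sym RZ.rotation-start)))
            (trans (sym Zβ≡Y′i+L) (sym Z′c≡Zβ))
      in n , W , circuit , even , ≤-trans n≤L+k (+-monoˡ-≤ k (≤-trans (m≤n+m L i) i+L≤m))
      where
      module RZ = Rotation k Z trail-Z closed-Z α (<⇒≤ α<k)
      Z′ = RZ.rotation
      disjoint′ : EdgeDisjoint L (shift i Y′) k Z′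
      disjoint′ e s e<L s<k same =
        let s′ , s′<k , Z′s≡Zs′ , Z′s+1≡Zs′+1 = RZ.rotatedStep⇒step s<k
        in disjoint e s′ e<L s′<k (SameEdge-resp refl refl Z′s≡Zs′ Z′s+1≡Zs′+1 same)

    viaRotatedY : (∃[ t′ ] t′ < m × Y′ t′ ≡ Y t × Y′ (suc t′) ≡ Y (suc t)) → EvenCircuitOfLength≤ R (m + k)
    viaRotatedY (t′ , t′<m , Y′t′≡Yt , Y′t′+1≡Yt+1) =
      viaEar (ear closed-Z (<-≤-trans z<s a<k) m Y′ RY.rotation-closed
                  (a , a<k , trans Za≡Yb (sym RY.rotation-start)) t′<m t′∉Z)
      where
      t′∉Z : ¬ EdgeOf k Z (Y′ t′) (Y′ (suc t′))
      t′∉Z (s , s<k , same) = t∉Z (s , s<k , SameEdge-resp Y′t′≡Yt Y′t′+1≡Yt+1 refl refl same)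

-- The prime factorization graph

Adj-sym : ∀ {E u v} → Adj E u v → Adj E v u
Adj-sym (inj₁ uv∈E) = inj₂ uv∈E
Adj-sym (inj₂ vu∈E) = inj₁ vu∈E

prime⇒≢1 : ∀ {p} → Prime p → p ≢ 1
prime⇒≢1 p-prime = nonTrivial⇒≢1 {{prime⇒nonTrivial p-prime}}

Pmed⇒≤ : ∀ {N p} → Pmed N p → p ≤ N
Pmed⇒≤ {N} {p} (p-prime , _ , p²≤N) = ≤-trans p≤p² p²≤N
  where
  p≤p² : p ≤ p ^ 2
  p≤p² = subst (p ≤_) (cong (p *_) (sym (*-identityʳ p)))
           (m≤m*n p p {{>-nonZero (<-trans z<s (nonTrivial⇒n>1 p {{prime⇒nonTrivial p-prime}}))}})

distinctPrimes∣⇒*∣ : ∀ {p q a} → Prime p → Prime q → p ≢ q → p ∣ a → q ∣ a → q * p ∣ a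
distinctPrimes∣⇒*∣ {p} {q} prime-p prime-q p≢q (divides x refl) q∣xp with euclidsLemma x p prime-q q∣xp
... | inj₁ (divides y refl) = divides y (*-assoc y q p)
... | inj₂ q∣p with prime⇒irreducible prime-p q∣p
...   | inj₁ refl = ⊥-elim (prime⇒≢1 prime-q refl)
...   | inj₂ q≡p = ⊥-elim (p≢q (sym q≡p))

<-squares⇒<-* : ∀ {N p q} → N < p ^ 2 → N < q ^ 2 → N < q * p
<-squares⇒<-* {N} {p} {q} N<p² N<q² with ≤-total p q
... | inj₁ p≤q = <-≤-trans (subst (N <_) (cong (p *_) (*-identityʳ p)) N<p²) (*-monoˡ-≤ p p≤q)
... | inj₂ q≤p = <-≤-trans (subst (N <_) (cong (q *_) (*-identityʳ q)) N<q²) (*-monoʳ-≤ q q≤p)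

¬Plarge-common-multiple : ∀ {N p q a} → Plarge N p → Plarge N q → p ≢ q →
  p ∣ a → q ∣ a → 1 ≤ a → a ≤ N → ⊥
¬Plarge-common-multiple {p = p} {q} (prime-p , N<p² , _) (prime-q , N<q² , _) p≢q p∣a q∣a 1≤a a≤N =
  <⇒≱ (<-squares⇒<-* {p = p} {q} N<p² N<q²)
      (≤-trans (∣⇒≤ {{>-nonZero 1≤a}} (distinctPrimes∣⇒*∣ prime-p prime-q p≢q p∣a q∣a)) a≤N)

module _ (N : ℕ) (A : List ℕ) where

  GA-Adj-sym : ∀ {u v} → GA-Adj N A u v → GA-Adj N A v u
  GA-Adj-sym (inj₁ 1-v) = inj₂ (inj₁ 1-v)
  GA-Adj-sym (inj₂ (inj₁ u-1)) = inj₁ u-1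
  GA-Adj-sym (inj₂ (inj₂ (big-u , big-v , u≢v , a , a∈A , u∣a , v∣a))) =
    inj₂ (inj₂ (big-v , big-u , u≢v ∘ sym , a , a∈A , v∣a , u∣a))

  Adj⊆GA-Adj : ∀ {E} → All (λ e → GA-Adj N A (proj₁ e) (proj₂ e)) E → ∀ {u v} → Adj E u v → GA-Adj N A u v
  Adj⊆GA-Adj E⊆G (inj₁ uv∈E) = All.lookup E⊆G uv∈E
  Adj⊆GA-Adj E⊆G (inj₂ vu∈E) = GA-Adj-sym (All.lookup E⊆G vu∈E)

  GA-Adj⇒Pmed-endpoint : InRange N A → ∀ {u v} → GA-Adj N A u v → u ≢ 1 → v ≢ 1 → Pmed N u ⊎ Pmed N v
  GA-Adj⇒Pmed-endpoint _ (inj₁ (u≡1 , _)) u≢1 _ = ⊥-elim (u≢1 u≡1)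
  GA-Adj⇒Pmed-endpoint _ (inj₂ (inj₁ (v≡1 , _))) _ v≢1 = ⊥-elim (v≢1 v≡1)
  GA-Adj⇒Pmed-endpoint _ (inj₂ (inj₂ (inj₂ med-u , _))) _ _ = inj₁ med-u
  GA-Adj⇒Pmed-endpoint _ (inj₂ (inj₂ (inj₁ _ , inj₂ med-v , _))) _ _ = inj₂ med-v
  GA-Adj⇒Pmed-endpoint inRange (inj₂ (inj₂ (inj₁ large-u , inj₁ large-v , u≢v , a , a∈A , u∣a , v∣a))) _ _ =
    let 1≤a , a≤N = All.lookup inRange a∈A
    in ⊥-elim (¬Plarge-common-multiple large-u large-v u≢v u∣a v∣a 1≤a a≤N)

  -- {1} ∪ P_{not □}, with the primes enumerated as in countPnsq.
  Charged : ℕ → Set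
  Charged v = v ∈ 1 ∷ filter (pnsq? N A) (upTo (suc N))

  Pmed∧¬Psq⇒Charged : ∀ {p} → Pmed N p → ¬ Psq N A p → Charged p
  Pmed∧¬Psq⇒Charged med-p ¬sq =
    there (∈-filter⁺ (pnsq? N A) (∈-upTo⁺ (s≤s (Pmed⇒≤ med-p))) (med-p , λ sq → ¬sq (med-p , sq)))

≡-either-≢ : ∀ {m x y v : ℕ} → m ≡ x ⊎ m ≡ y → x ≢ v → y ≢ v → m ≢ v
≡-either-≢ (inj₁ refl) x≢v _ = x≢v
≡-either-≢ (inj₂ refl) _ y≢v = y≢v

module _ (N : ℕ) (A : List ℕ) (inRange : InRange N A)
         {R : ℕ → ℕ → Set} (R⊆G : ∀ {u v} → R u v → GA-Adj N A u v)
         {k : ℕ} {w : ℕ → ℕ} (cycle : Cycle R k w) (¬Psq : ∀ i → i < k → ¬ Psq N A (w i)) where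

  private
    closed = proj₁ (proj₂ (proj₁ cycle))
    steps = proj₂ (proj₂ (proj₁ cycle))
    0<k = <-≤-trans z<s (proj₁ (proj₁ cycle))

  chargedEndpoint : ∀ {i} → i < k → w i ≢ 1 → w (suc i) ≢ 1 →
    ∃[ m ] OnWalk k w m × Charged N A m × (m ≡ w i ⊎ m ≡ w (suc i))
  chargedEndpoint {i} i<k wi≢1 wi+1≢1 with GA-Adj⇒Pmed-endpoint N A inRange (R⊆G (steps i i<k)) wi≢1 wi+1≢1
  ... | inj₁ med = w i , (i , i<k , refl) , Pmed∧¬Psq⇒Charged N A med (¬Psq i i<k) , inj₁ refl
  ... | inj₂ med with OnWalk-suc closed 0<k i<k
  ...   | j , j<k , wj≡wi+1 = w (suc i) , (j , j<k , wj≡wi+1) ,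
          Pmed∧¬Psq⇒Charged N A med (subst (¬_ ∘ Psq N A) wj≡wi+1 (¬Psq j j<k)) , inj₂ refl

  -- An edge avoiding 1 has a medium, hence charged, endpoint m; the second charged vertex is 1 if it lies on
  -- the cycle, and otherwise a medium endpoint of an edge avoiding m.
  twoChargedVertices : ∃[ u ] ∃[ v ] u ≢ v × OnWalk k w u × OnWalk k w v × Charged N A u × Charged N A v
  twoChargedVertices with cycle-edgeAvoiding {R} cycle 1
  ... | i , i<k , wi≢1 , wi+1≢1 with chargedEndpoint i<k wi≢1 wi+1≢1
  ...   | m , m∈w , charged-m , m-endpoint with onWalk? k w 1
  ...     | yes 1∈w = 1 , m , ≡-either-≢ m-endpoint wi≢1 wi+1≢1 ∘ sym , 1∈w , m∈w , here refl , charged-m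
  ...     | no 1∉w with cycle-edgeAvoiding {R} cycle m
  ...       | j , j<k , wj≢m , wj+1≢m with chargedEndpoint j<k (λ wj≡1 → 1∉w (j , j<k , wj≡1))
                                              (λ wj+1≡1 → 1∉w (subst (OnWalk k w) wj+1≡1 (OnWalk-suc closed 0<k j<k)))
  ...         | m′ , m′∈w , charged-m′ , m′-endpoint =
                m , m′ , ≡-either-≢ m′-endpoint wj≢m wj+1≢m ∘ sym , m∈w , m′∈w , charged-m , charged-m′

-- Deciding whether a graph has a short cycle

-- Lists of vertices are read as walks; the value 0 past the end is never inspected.
listWalk : List ℕ → ℕ → ℕ
listWalk [] i = 0
listWalk (x ∷ xs) zero = x
listWalk (x ∷ xs) (suc i) = listWalk xs i

listWalk-applyUpTo : ∀ w n {i} → i < n → listWalk (applyUpTo w n) i ≡ w i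
listWalk-applyUpTo w (suc n) {zero} _ = refl
listWalk-applyUpTo w (suc n) {suc i} (s≤s i<n) = listWalk-applyUpTo (w ∘ suc) n i<n

Cycle-cong : ∀ {R k w w′} → (∀ {i} → i ≤ k → w i ≡ w′ i) → Cycle R k w → Cycle R k w′
Cycle-cong {R} {k} w≗w′ ((3≤k , closed , steps) , injective) =
  (3≤k , trans (sym (w≗w′ ≤-refl)) (trans closed (w≗w′ z≤n)) ,
   λ i i<k → subst₂ R (w≗w′ (<⇒≤ i<k)) (w≗w′ i<k) (steps i i<k)) ,
  λ i j i<k j<k w′i≡w′j →
    injective i j i<k j<k (trans (w≗w′ (<⇒≤ i<k)) (trans w′i≡w′j (sym (w≗w′ (<⇒≤ j<k)))))

cycle? : ∀ {R} → (∀ u v → Dec (R u v)) → ∀ k w → Dec (Cycle R k w)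
cycle? R? k w =
  (3 ≤? k ×-dec w k ≟ w 0 ×-dec ∀<? (λ i → R? (w i) (w (suc i))) k) ×-dec
  map′ (λ inj i j i<k j<k → inj i i<k j j<k) (λ inj i i<k j j<k → inj i j i<k j<k)
    (∀<? (λ i → ∀<? (λ j → w i ≟ w j →-dec i ≟ j) k) k)

∃-word? : ∀ (V : List ℕ) n {P : List ℕ → Set} → Decidable P → Dec (∃[ l ] length l ≡ n × All (_∈ V) l × P l)
∃-word? V zero P? = map′ (λ p → [] , refl , [] , p) (λ { ([] , _ , _ , p) → p }) (P? [])
∃-word? V (suc n) {P} P? = map′ extend split (any? (λ x → ∃-word? V n (P? ∘ (x ∷_))) V)
  where
  Words : ℕ → (List ℕ → Set) → Set
  Words n P = ∃[ l ] length l ≡ n × All (_∈ V) l × P l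
  extend : Any (λ x → Words n (P ∘ (x ∷_))) V → Words (suc n) P
  extend any with find any
  ... | x , x∈V , l , length≡n , l⊆V , p = x ∷ l , cong suc length≡n , x∈V ∷ l⊆V , p
  split : Words (suc n) P → Any (λ x → Words n (P ∘ (x ∷_))) V
  split (x ∷ l , length≡ , x∈V ∷ l⊆V , p) = lose x∈V (l , suc-injective length≡ , l⊆V , p)

ShortCycle : (ℕ → ℕ → Set) → ℕ → Set
ShortCycle R N = ∃[ k ] ∃[ w ] Cycle R k w × k ^ 12 ≤ N

module _ {R : ℕ → ℕ → Set} (R? : ∀ u v → Dec (R u v)) (V : List ℕ) (R⊆V : ∀ {u v} → R u v → u ∈ V) where

  Cycle⇒vertices∈ : ∀ {k w} → Cycle R k w → ∀ {i} → i < suc k → w i ∈ V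
  Cycle⇒vertices∈ ((3≤k , closed , steps) , _) {i} i<1+k with m≤n⇒m<n∨m≡n (s≤s⁻¹ i<1+k)
  ... | inj₁ i<k = R⊆V (steps i i<k)
  ... | inj₂ refl = subst (_∈ V) (sym closed) (R⊆V (steps 0 (<-≤-trans z<s 3≤k)))

  cycleOfLength? : ∀ k → Dec (∃[ w ] Cycle R k w)
  cycleOfLength? k = map′ (λ (l , _ , _ , c) → listWalk l , c) fromCycle (∃-word? V (suc k) (cycle? R? k ∘ listWalk))
    where
    fromCycle : ∃[ w ] Cycle R k w → ∃[ l ] length l ≡ suc k × All (_∈ V) l × Cycle R k (listWalk l)
    fromCycle (w , c) = applyUpTo w (suc k) , length-applyUpTo w (suc k) ,
      applyUpTo⁺₁ w (suc k) (Cycle⇒vertices∈ c) ,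
      Cycle-cong {R} (λ i≤k → sym (listWalk-applyUpTo w (suc k) (s≤s i≤k))) c

  n≤n^12 : ∀ n → n ≤ n ^ 12
  n≤n^12 zero = z≤n
  n≤n^12 (suc n) = m≤m*n (suc n) (suc n ^ 11) {{m^n≢0 (suc n) 11}}

  shortCycle? : ∀ N → Dec (ShortCycle R N)
  shortCycle? N = map′ (λ (k , _ , short , w , c) → k , w , c , short)
                       (λ (k , w , c , short) → k , s≤s (≤-trans (n≤n^12 k) short) , short , w , c)
                       (∃<? (λ k → k ^ 12 ≤? N ×-dec cycleOfLength? k) (suc N))

∈-─ : ∀ {x z : ℕ} {ys} (x∈ys : x ∈ ys) → z ∈ ys → z ≢ x → z ∈ ys ─ x∈ys
∈-─ (here refl) (here refl) z≢x = ⊥-elim (z≢x refl)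
∈-─ (here refl) (there z∈ys) _ = z∈ys
∈-─ (there x∈ys) (here refl) _ = here refl
∈-─ (there x∈ys) (there z∈ys) z≢x = there (∈-─ x∈ys z∈ys z≢x)

Unique⇒length≤ : ∀ {S T : List ℕ} → Unique S → All (_∈ T) S → length S ≤ length T
Unique⇒length≤ [] [] = z≤n
Unique⇒length≤ {x ∷ S} {T} (x∉S ∷ unique) (x∈T ∷ S⊆T) = begin
  suc (length S)         ≤⟨ s≤s (Unique⇒length≤ unique S⊆T─x) ⟩
  suc (length (T ─ x∈T)) ≡⟨ length-removeAt′ T (index x∈T) ⟨
  length T               ∎
  where
  open ≤-Reasoning
  S⊆T─x : All (_∈ T ─ x∈T) S
  S⊆T─x = All.zipWith (λ (z∈T , x≢z) → ∈-─ x∈T z∈T (x≢z ∘ sym)) (S⊆T , x∉S)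

^12-+-bound : ∀ {N n m k} → m ^ 12 ≤ N → k ^ 12 ≤ N → n ≤ m + k → n ^ 12 ≤ 2 ^ 12 * N
^12-+-bound {N} {n} {m} {k} m^12≤N k^12≤N n≤m+k = begin
  n ^ 12                ≤⟨ ^-monoˡ-≤ 12 n≤2*max ⟩
  (2 * (m ⊔ k)) ^ 12    ≡⟨ ^-distrib-* 2 (m ⊔ k) 12 ⟩
  2 ^ 12 * (m ⊔ k) ^ 12 ≤⟨ *-monoʳ-≤ (2 ^ 12) max^12≤N ⟩
  2 ^ 12 * N            ∎
  where
  open ≤-Reasoning
  n≤2*max : n ≤ 2 * (m ⊔ k)
  n≤2*max = ≤-trans n≤m+k (subst (m + k ≤_) (cong (m ⊔ k +_) (sym (+-identityʳ (m ⊔ k))))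
                                    (+-mono-≤ (m≤m⊔n m k) (m≤n⊔m m k)))
  max^12≤N : (m ⊔ k) ^ 12 ≤ N
  max^12≤N with ⊔-sel m k
  ... | inj₁ m⊔k≡m rewrite m⊔k≡m = m^12≤N
  ... | inj₂ m⊔k≡k rewrite m⊔k≡k = k^12≤N

-- The greedy deletion

Adj-resp-SameEdge : ∀ {E a b c d} → SameEdge a b c d → Adj E a b → Adj E c d
Adj-resp-SameEdge (inj₁ (refl , refl)) adj = adj
Adj-resp-SameEdge (inj₂ (refl , refl)) adj = Adj-sym adj

Adj-∷ : ∀ {E e u v} → Adj E u v → Adj (e ∷ E) u v
Adj-∷ (inj₁ uv∈E) = inj₁ (there uv∈E)
Adj-∷ (inj₂ vu∈E) = inj₂ (there vu∈E)

Adj⇒oriented : ∀ {E E′ u v} → Adj E u v → ∃[ e ] e ∈ E × Adj (e ∷ E′) u v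
Adj⇒oriented {u = u} {v} (inj₁ uv∈E) = (u , v) , uv∈E , inj₁ (here refl)
Adj⇒oriented {u = u} {v} (inj₂ vu∈E) = (v , u) , vu∈E , inj₂ (here refl)

endpoints : List (ℕ × ℕ) → List ℕ
endpoints E = map proj₁ E ++ map proj₂ E

Adj⇒∈endpoints : ∀ {E u v} → Adj E u v → u ∈ endpoints E
Adj⇒∈endpoints (inj₁ uv∈E) = ∈-++⁺ˡ (∈-map⁺ proj₁ uv∈E)
Adj⇒∈endpoints {E} (inj₂ vu∈E) = ∈-++⁺ʳ (map proj₁ E) (∈-map⁺ proj₂ vu∈E)

Adj? : ∀ E u v → Dec (Adj E u v)
Adj? E u v = ((u , v) ∈? E) ⊎-dec ((v , u) ∈? E)

AdjMinus? : ∀ E E′ u v → Dec (AdjMinus E E′ u v)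
AdjMinus? E E′ u v = Adj? E u v ×-dec ¬? (Adj? E′ u v)

fuel-exhausted : ∀ {c s} → c ≤ s + 0 → ¬ (2 + s ≤ c)
fuel-exhausted {c} {s} c≤s+0 2+s≤c =
  1+n≰n (≤-trans (n≤1+n (suc s)) (≤-trans 2+s≤c (subst (c ≤_) (+-identityʳ s) c≤s+0)))

fuel-step : ∀ {c s f} → c ≤ s + suc f → c ≤ 2 + s + f
fuel-step {c} {s} {f} c≤s+1+f = ≤-trans c≤s+1+f (≤-trans (≤-reflexive (+-suc s f)) (n≤1+n _))

module Greedy (N : ℕ) (A : List ℕ) (inRange : InRange N A)
  (E : List (ℕ × ℕ)) (E⊆G : All (λ e → GA-Adj N A (proj₁ e) (proj₂ e)) E)
  (noShortEvenCircuit : ∀ k w → Circuit (Adj E) k w → Even k → ¬ (k ^ 12 ≤ (2 ^ 12) * N))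
  (noShortOddCycleThroughPsq : ∀ k w → Cycle (Adj E) k w → Odd k → k ^ 12 ≤ N →
                                 ¬ (Σ ℕ λ i → i < k × Psq N A (w i))) where

  OnShortCycleThrough : List (ℕ × ℕ) → ℕ → Set
  OnShortCycleThrough E′ v = ∃[ k ] ∃[ w ] Cycle (Adj E) k w × k ^ 12 ≤ N × OnWalk k w v ×
    ∃[ t ] t < k × Adj E′ (w t) (w (suc t))

  OnShortCycleThrough-∷ : ∀ {E′ e v} → OnShortCycleThrough E′ v → OnShortCycleThrough (e ∷ E′) v
  OnShortCycleThrough-∷ (k , w , cycle , short , v∈w , t , t<k , adj) =
    k , w , cycle , short , v∈w , t , t<k , Adj-∷ adj

  record Invariant (E′ : List (ℕ × ℕ)) (S : List ℕ) : Set where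
    field
      E′⊆E : All (_∈ E) E′
      unique : Unique S
      charged : All (Charged N A) S
      2∣E′∣≤∣S∣ : 2 * length E′ ≤ length S
      onCycleThroughE′ : All (OnShortCycleThrough E′) S

    ∣S∣≤∣P∣+1 : length S ≤ countPnsq N A + 1
    ∣S∣≤∣P∣+1 = subst (length S ≤_) (+-comm 1 (countPnsq N A)) (Unique⇒length≤ unique charged)

  module _ {E′ k w} (cycle : Cycle (AdjMinus E E′) k w) (short : k ^ 12 ≤ N) where

    private
      cycleE : Cycle (Adj E) k w
      cycleE = Cycle-mono {AdjMinus E E′} proj₁ cycle
      closed = proj₁ (proj₂ (proj₁ cycle))
      steps = proj₂ (proj₂ (proj₁ cycle))
      0<k = <-≤-trans z<s (proj₁ (proj₁ cycle))

    shortCycle⇒odd : Odd k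
    shortCycle⇒odd with Even⊎Odd k
    ... | inj₂ odd = odd
    ... | inj₁ even =
      ⊥-elim (noShortEvenCircuit k w (cycle⇒circuit {Adj E} cycleE) even (≤-trans short (m≤n*m N (2 ^ 12))))

    shortCycle⇒¬Psq : ∀ i → i < k → ¬ Psq N A (w i)
    shortCycle⇒¬Psq i i<k sq = noShortOddCycleThroughPsq k w cycleE shortCycle⇒odd short (i , i<k , sq)

    -- Otherwise the two short cycles would span an even circuit of length at most 2 N^{1/12}.
    shortCycle⇒¬OnShortCycleThrough : ∀ {v} → OnWalk k w v → ¬ OnShortCycleThrough E′ v
    shortCycle⇒¬OnShortCycleThrough (a , a<k , wa≡v)
        (m , Y , cycleY@((_ , closed-Y , _) , _) , shortY , (b , b<m , Yb≡v) , t , t<m , Yt∈E′) =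
      let n , W , circuit , even , n≤m+k = oddClosedTrail∪closedTrail⇒evenCircuit Adj-sym
            k w (cycle⇒trail {Adj E} cycleE) closed shortCycle⇒odd m Y (cycle⇒trail {Adj E} cycleY) closed-Y
            a<k b<m (trans wa≡v (sym Yb≡v)) t<m Yt∉w
      in noShortEvenCircuit n W circuit even (^12-+-bound {N} {n} {m} {k} shortY short n≤m+k)
      where
      Yt∉w : ¬ EdgeOf k w (Y t) (Y (suc t))
      Yt∉w (s , s<k , same) = proj₂ (steps s s<k) (Adj-resp-SameEdge same Yt∈E′)

    greedyStep : ∀ {S} → Invariant E′ S → ∃[ e ] ∃[ u ] ∃[ v ] Invariant (e ∷ E′) (u ∷ v ∷ S)
    greedyStep {S} inv with Adj⇒oriented {E′ = E′} (proj₁ (steps 0 0<k))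
                          | twoChargedVertices N A inRange (Adj⊆GA-Adj N A E⊆G) cycleE shortCycle⇒¬Psq
    ... | e , e∈E , w0w1∈e∷E′ | u , v , u≢v , u∈w , v∈w , charged-u , charged-v = e , u , v , record
      { E′⊆E = e∈E ∷ E′⊆E
      ; unique = (u≢v ∷ notInS u∈w) ∷ notInS v∈w ∷ unique
      ; charged = charged-u ∷ charged-v ∷ charged
      ; 2∣E′∣≤∣S∣ = ≤-trans (≤-reflexive (*-suc 2 (length E′))) (+-monoʳ-≤ 2 2∣E′∣≤∣S∣)
      ; onCycleThroughE′ = throughNewEdge u∈w ∷ throughNewEdge v∈w ∷ All.map OnShortCycleThrough-∷ onCycleThroughE′
      }
      where
      open Invariant inv
      notInS : ∀ {x} → OnWalk k w x → All (x ≢_) S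
      notInS x∈w = All.map (λ {y} y∈C x≡y →
        shortCycle⇒¬OnShortCycleThrough x∈w (subst (OnShortCycleThrough E′) (sym x≡y) y∈C)) onCycleThroughE′
      throughNewEdge : ∀ {x} → OnWalk k w x → OnShortCycleThrough (e ∷ E′) x
      throughNewEdge x∈w = k , w , cycleE , short , x∈w , 0 , 0<k , w0w1∈e∷E′

  Result : Set
  Result = Σ (List (ℕ × ℕ)) λ E′ → All (_∈ E) E′ × 2 * length E′ ≤ countPnsq N A + 1 ×
    (∀ k w → Cycle (AdjMinus E E′) k w → ¬ (k ^ 12 ≤ N))

  finish : ∀ {E′ S} → Invariant E′ S → ¬ ShortCycle (AdjMinus E E′) N → Result
  finish {E′} inv noShortCycle =
    E′ , E′⊆E , ≤-trans 2∣E′∣≤∣S∣ ∣S∣≤∣P∣+1 , λ k w cycle short → noShortCycle (k , w , cycle , short)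
    where open Invariant inv

  -- Each round charges two new vertices, of which there are at most countPnsq N A + 1.
  mutual
    greedy : ∀ fuel {E′ S} → Invariant E′ S → countPnsq N A + 1 ≤ length S + fuel → Result
    greedy fuel {E′} inv enoughFuel with shortCycle? (AdjMinus? E E′) (endpoints E) (Adj⇒∈endpoints ∘ proj₁) N
    ... | no noShortCycle = finish inv noShortCycle
    ... | yes (k , w , cycle , short) =
      let _ , _ , _ , inv′ = greedyStep cycle short inv in greedyAfterStep fuel inv′ enoughFuel

    greedyAfterStep : ∀ fuel {E′ S e u v} → Invariant (e ∷ E′) (u ∷ v ∷ S) →
      countPnsq N A + 1 ≤ length S + fuel → Result
    greedyAfterStep zero inv′ noFuel = ⊥-elim (fuel-exhausted noFuel (Invariant.∣S∣≤∣P∣+1 inv′))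
    greedyAfterStep (suc fuel) inv′ enoughFuel = greedy fuel inv′ (fuel-step enoughFuel)

  start : Invariant [] []
  start = record { E′⊆E = [] ; unique = [] ; charged = [] ; 2∣E′∣≤∣S∣ = z≤n ; onCycleThroughE′ = [] }

lemma3p7 : (N : ℕ) (A : List ℕ) → Unique A → InRange N A →
    DistinctSubsetProducts A → VInjective N A → VNonzero N A →
    (E : List (ℕ × ℕ)) → All (λ e → GA-Adj N A (proj₁ e) (proj₂ e)) E →
    (∀ k w → Circuit (Adj E) k w → Even k → ¬ (k ^ 12 ≤ (2 ^ 12) * N)) →
    (∀ k w → Cycle (Adj E) k w → Odd k → k ^ 12 ≤ N →
      ¬ (Σ ℕ λ i → i < k × Psq N A (w i))) →
    Σ (List (ℕ × ℕ)) λ E' → All (_∈ E) E' × 2 * length E' ≤ countPnsq N A + 1 ×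
      (∀ k w → Cycle (AdjMinus E E') k w → ¬ (k ^ 12 ≤ N))
lemma3p7 N A _ inRange _ _ _ E E⊆G noShortEvenCircuit noShortOddCycleThroughPsq =
  greedy (countPnsq N A + 1) start ≤-refl
  where open Greedy N A inRange E E⊆G noShortEvenCircuit noShortOddCycleThroughPsq
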